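{- Let $A$ be a dendriform algebra, $n\ge 2$, and $a_1,\ldots,a_n\in A$. (i) If $\sigma\in S_n$ satisfies $\sigma_n=n$, then $T_\sigma(a_1,\ldots,a_n)=T_{\widetilde\sigma}(a_1,\ldots,a_{n-1})*a_n$, where $\widetilde\sigma\in S_{n-1}$ is the restriction of $\sigma$ to $\{1,\ldots,n-1\}$. (ii) If $k\in\{1,\ldots,n-1\}$ and $\sigma\in S_n$ is such that $\sigma_j=n$ and $\sigma_{j+1}=k$ for some $j$, then $$T_\sigma(a_1,\ldots,a_n)=T_{\widetilde\sigma}(a_1,\ldots,a_{k-1},a_{k+1},\ldots,a_{n-1},a_n\rhd a_k),$$ where $\widetilde\sigma\in S_{n-1}$ is obtained from the word $(\sigma_1,\ldots,\sigma_n)$ by replacing the consecutive pair $(n,k)$ by the single letter $n-1$ and replacing each letter $i\in\{k+1,\ldots,n-1\}$ by $i-1$.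
   Context: A dendriform algebra is a vector space $A$ with bilinear operations $\prec,\succ$ satisfying $(a\prec b)\prec c=a\prec(b*c)$, $(a\succ b)\prec c=a\succ(b\prec c)$, $a\succ(b\succ c)=(a*b)\succ c$, where $a*b:=a\prec b+a\succ b$ (associative). Put $a\rhd b:=a\succ b-b\prec a$ and $\ell^{(m)}(b_1,\ldots,b_m):=(\cdots((b_1\rhd b_2)\rhd b_3)\cdots)\rhd b_m$, $\ell^{(1)}(b)=b$. Write $\sigma_i=\sigma(i)$. For $\sigma\in S_m$ and $b_1,\ldots,b_m\in A$, let $E_\sigma$ be the set of $k\in\{1,\ldots,m-1\}$ with $\sigma_{k+1}>\sigma_j$ for all $j\le k$; write $E_\sigma=\{k_1<\cdots<k_p\}$, $k_0:=0$, $k_{p+1}:=m$, and $T_\sigma(b_1,\ldots,b_m):=\ell^{(k_1-k_0)}(b_{\sigma_{k_0+1}},\ldots,b_{\sigma_{k_1}})*\cdots*\ell^{(k_{p+1}-k_p)}(b_{\sigma_{k_p+1}},\ldots,b_{\sigma_m})$. -}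

module Defs where

open import Level using (Level; _⊔_) renaming (suc to lsuc)
open import Algebra.Bundles using (CommutativeRing)
open import Algebra.Module.Bundles using (Module)
open import Data.Nat using (ℕ; zero; suc; _<ᵇ_; _≡ᵇ_; _∸_)
open import Data.Bool using (Bool; true; false; if_then_else_; not; _∨_; _∧_)
open import Data.Fin using (Fin; toℕ; inject₁; fromℕ)
import Data.Fin as Fin
open import Data.Fin.Permutation using (Permutation′; _⟨$⟩ʳ_)
open import Data.List using (List; []; _∷_; map; allFin)
open import Data.Bool.ListAction using (all)
open import Data.Product using (_×_; _,_)

record DendriformAlgebra {r ℓr : Level} (R : CommutativeRing r ℓr) (m ℓm : Level)
       : Set (r ⊔ ℓr ⊔ lsuc (m ⊔ ℓm)) where
  open CommutativeRing R using () renaming (Carrier to K)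
  field
    module′ : Module R m ℓm
  open Module module′ public
  infixl 7 _≺_ _≻_ _✶_
  field
    _≺_ : Carrierᴹ → Carrierᴹ → Carrierᴹ
    _≻_ : Carrierᴹ → Carrierᴹ → Carrierᴹ
    ≺-cong : ∀ {a a′ b b′} → a ≈ᴹ a′ → b ≈ᴹ b′ → (a ≺ b) ≈ᴹ (a′ ≺ b′)
    ≻-cong : ∀ {a a′ b b′} → a ≈ᴹ a′ → b ≈ᴹ b′ → (a ≻ b) ≈ᴹ (a′ ≻ b′)
    ≺-+ˡ : ∀ a b c → ((a +ᴹ b) ≺ c) ≈ᴹ ((a ≺ c) +ᴹ (b ≺ c))
    ≺-+ʳ : ∀ a b c → (a ≺ (b +ᴹ c)) ≈ᴹ ((a ≺ b) +ᴹ (a ≺ c))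
    ≻-+ˡ : ∀ a b c → ((a +ᴹ b) ≻ c) ≈ᴹ ((a ≻ c) +ᴹ (b ≻ c))
    ≻-+ʳ : ∀ a b c → (a ≻ (b +ᴹ c)) ≈ᴹ ((a ≻ b) +ᴹ (a ≻ c))
    ≺-*ˡ : ∀ (λ′ : K) a b → ((λ′ *ₗ a) ≺ b) ≈ᴹ (λ′ *ₗ (a ≺ b))
    ≺-*ʳ : ∀ (λ′ : K) a b → (a ≺ (λ′ *ₗ b)) ≈ᴹ (λ′ *ₗ (a ≺ b))
    ≻-*ˡ : ∀ (λ′ : K) a b → ((λ′ *ₗ a) ≻ b) ≈ᴹ (λ′ *ₗ (a ≻ b))
    ≻-*ʳ : ∀ (λ′ : K) a b → (a ≻ (λ′ *ₗ b)) ≈ᴹ (λ′ *ₗ (a ≻ b))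

  _✶_ : Carrierᴹ → Carrierᴹ → Carrierᴹ
  a ✶ b = (a ≺ b) +ᴹ (a ≻ b)

  field
    dend₁ : ∀ a b c → ((a ≺ b) ≺ c) ≈ᴹ (a ≺ (b ✶ c))
    dend₂ : ∀ a b c → ((a ≻ b) ≺ c) ≈ᴹ (a ≻ (b ≺ c))
    dend₃ : ∀ a b c → (a ≻ (b ≻ c)) ≈ᴹ ((a ✶ b) ≻ c)

  infixl 6 _▷_
  _▷_ : Carrierᴹ → Carrierᴹ → Carrierᴹ
  a ▷ b = (a ≻ b) +ᴹ (-ᴹ (b ≺ a))

  -- ℓ^{(m)}(b₁,…,bₘ) = (⋯((b₁ ▷ b₂) ▷ b₃)⋯) ▷ bₘ, written as ℓ b₁ (b₂ ∷ … ∷ bₘ ∷ [])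
  ℓ : Carrierᴹ → List Carrierᴹ → Carrierᴹ
  ℓ b []       = b
  ℓ b (c ∷ cs) = ℓ (b ▷ c) cs

  -- Assembling blocks: 'cur' is the ℓ-value of the current block so far; each
  -- further letter carries a flag saying whether it starts a new block.
  -- Result: ℓ(block₁) * (ℓ(block₂) * ( ⋯ * ℓ(block_{p+1}))) (* is associative).
  assemble : Carrierᴹ → List (Bool × Carrierᴹ) → Carrierᴹ
  assemble cur []                 = cur
  assemble cur ((true  , x) ∷ xs) = cur ✶ assemble x xs
  assemble cur ((false , x) ∷ xs) = assemble (cur ▷ x) xs

  -- Position i (0-indexed, i ≥ 1) starts a new block iff i ∈ E_σ, i.e.
  -- σ(i) > σ(j) for all j < i.
  inE : ∀ {n} → Permutation′ n → Fin n → Bool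
  inE {n} σ i = all (λ j → not (toℕ j <ᵇ toℕ i) ∨ (toℕ (σ ⟨$⟩ʳ j) <ᵇ toℕ (σ ⟨$⟩ʳ i))) (allFin n)

  -- T_σ(b₁,…,bₘ) for m = suc k ≥ 1 (indices 0-based: b : Fin m → A).
  T : ∀ {k} → Permutation′ (suc k) → (Fin (suc k) → Carrierᴹ) → Carrierᴹ
  T {k} σ b = assemble (b (σ ⟨$⟩ʳ Fin.zero))
                (map (λ i → inE σ (Fin.suc i) , b (σ ⟨$⟩ʳ Fin.suc i)) (allFin k))

  -- For a : Fin (n) → A with n = suc (suc k) and k₀ : Fin (suc k) (k₀ = k - 1 in the
  -- paper's 1-based notation), the (n-1)-tuple (a₁,…,a_{k-1},a_{k+1},…,a_{n-1}, aₙ ▷ a_k).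
  dropInsert : ∀ {k} → (Fin (suc (suc k)) → Carrierᴹ) → Fin (suc k) → Fin (suc k) → Carrierᴹ
  dropInsert {k} a k₀ i =
    if toℕ i <ᵇ toℕ k₀ then a (inject₁ i)
    else if toℕ i ≡ᵇ k then (a (fromℕ (suc k)) ▷ a (inject₁ k₀))
    else a (Fin.suc i)

word : ∀ {n} → Permutation′ n → List ℕ
word {n} σ = map (λ i → toℕ (σ ⟨$⟩ʳ i)) (allFin n)

-- Word transformation of part (ii), 0-based: 'top' = n-1 (the paper's n), k₀ = k-1.
-- Replace the consecutive pair (top, k₀) by top-1, and each letter x with
-- k₀ < x < top by x-1.
contractWord : ℕ → ℕ → List ℕ → List ℕ
contractWord top k₀ [] = []
contractWord top k₀ (x ∷ [])      = dec x ∷ []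
  where dec : ℕ → ℕ
        dec x = if (k₀ <ᵇ x) ∧ (x <ᵇ top) then x ∸ 1 else x
contractWord top k₀ (x ∷ yr@(y ∷ r)) =
  if (x ≡ᵇ top) ∧ (y ≡ᵇ k₀) then (top ∸ 1) ∷ contractWord top k₀ r
  else dec x ∷ contractWord top k₀ yr
  where dec : ℕ → ℕ
        dec x = if (k₀ <ᵇ x) ∧ (x <ᵇ top) then x ∸ 1 else x

-- T_σ only depends on the word σ₁⋯σₙ: reading it left to right, a letter opens a new
-- block exactly when it exceeds the running maximum, and is otherwise absorbed into the
-- current block by ▷. So T_σ only sees the relative order of the letters, and relabelling
-- them by a strictly monotone map changes nothing.
-- (i) The last letter n is a new maximum, so it forms a block of its own at the end, which
-- splits off as * aₙ by associativity of *.
-- (ii) The letter n opens a block and the next letter k < n is absorbed into it, so the pair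
-- may be replaced by one letter carrying aₙ ▷ a_k under the key n. Closing the gap at k
-- (i ↦ i - 1 for i > k) is strictly monotone away from k and turns this word into that of σ̃.
module Submission where

open import Level using (Level)
open import Function using (_∘_; Injection)
open import Function.Properties.Inverse using (↔⇒↣)
open import Algebra.Bundles using (CommutativeRing)
open import Data.Bool using (Bool; true; false; if_then_else_)
open import Data.Bool.Properties using (∧-identityʳ)
open import Data.Bool.ListAction using (all)
open import Data.Nat
  using (ℕ; zero; suc; pred; _≤_; _<_; _<ᵇ_; _≡ᵇ_; _<?_; z≤n; z<s; s<s; s<s⁻¹; s≤s⁻¹; >-nonZero)
open import Data.Nat.Properties
  using (<ᵇ-reflects-<; ≡ᵇ⇒≡; ≡⇒≡ᵇ; <-cmp; <-irrefl; <-asym; <-trans; ≤-<-trans; <-≤-trans;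
         ≮⇒≥; ≤⇒≯; ≤∧≢⇒<; <⇒≢; <⇒≤pred; pred-mono-<)
open import Data.Fin using (Fin; zero; suc; toℕ; inject₁; fromℕ; fromℕ<)
import Data.Fin as Fin
open import Data.Fin.Properties using (toℕ-injective; toℕ-inject₁; toℕ-fromℕ; fromℕ<-toℕ; toℕ<n)
open import Data.Fin.Permutation using (Permutation′; _⟨$⟩ʳ_)
open import Data.List using (List; []; _∷_; _++_; map; tabulate; allFin)
open import Data.List.Properties using (map-tabulate; tabulate-cong; map-++)
open import Data.List.Relation.Unary.All as All using (All; []; _∷_)
open import Data.List.Relation.Unary.All.Properties using (++⁻; ++⁺; map⁺; tabulate⁺)
open import Data.List.Relation.Unary.AllPairs using (_∷_)
open import Data.List.Relation.Unary.Unique.Propositional using (Unique)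
import Data.List.Relation.Unary.Unique.Propositional.Properties as Unique
open import Data.List.Membership.Propositional.Properties using (∈-allFin)
open import Data.Product using (_×_; _,_; proj₁; proj₂; map₁; map₂; ∃-syntax; ∃₂; uncurry)
open import Relation.Binary.Definitions using (tri<; tri≈; tri>)
open import Relation.Binary.PropositionalEquality
  using (_≡_; _≢_; refl; sym; trans; cong; cong₂; subst; ≢-sym; module ≡-Reasoning)
import Relation.Binary.Reasoning.Setoid as SetoidReasoning
open import Relation.Nullary using (¬_; contradiction; yes; no)
open import Relation.Nullary.Reflects
  using (Reflects; ofʸ; ofⁿ; det; fromEquivalence; _→-reflects_; _×-reflects_)

open import Defs

private
  variable
    a : Level
    A : Set a
    m n u v : ℕ

<ᵇ-true : m < n → (m <ᵇ n) ≡ true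
<ᵇ-true {m} {n} m<n = det (<ᵇ-reflects-< m n) (ofʸ m<n)

<ᵇ-false : ¬ m < n → (m <ᵇ n) ≡ false
<ᵇ-false {m} {n} m≮n = det (<ᵇ-reflects-< m n) (ofⁿ m≮n)

≡ᵇ-reflects-≡ : ∀ m n → Reflects (m ≡ n) (m ≡ᵇ n)
≡ᵇ-reflects-≡ m n = fromEquivalence (≡ᵇ⇒≡ m n) (≡⇒≡ᵇ m n)

≡ᵇ-refl : ∀ n → (n ≡ᵇ n) ≡ true
≡ᵇ-refl n = det (≡ᵇ-reflects-≡ n n) (ofʸ refl)

≡ᵇ-false : m ≢ n → (m ≡ᵇ n) ≡ false
≡ᵇ-false {m} {n} m≢n = det (≡ᵇ-reflects-≡ m n) (ofⁿ m≢n)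

Reflects-map : ∀ {p} {B : Set p} {x : Bool} → (A → B) → (B → A) → Reflects A x → Reflects B x
Reflects-map f g (ofʸ a) = ofʸ (f a)
Reflects-map f g (ofⁿ ¬a) = ofⁿ (¬a ∘ g)

all-reflects : ∀ {p} {P : A → Set p} {q : A → Bool} →
  (∀ x → Reflects (P x) (q x)) → ∀ xs → Reflects (All P xs) (all q xs)
all-reflects r []       = ofʸ []
all-reflects r (x ∷ xs) = Reflects-map (uncurry _∷_) All.uncons (r x ×-reflects all-reflects r xs)

tabulate-∷ʳ : ∀ {n} (f : Fin (suc n) → A) → tabulate f ≡ tabulate (f ∘ inject₁) ++ f (fromℕ n) ∷ []
tabulate-∷ʳ {n = zero}  f = refl
tabulate-∷ʳ {n = suc n} f = cong (f zero ∷_) (tabulate-∷ʳ (f ∘ suc))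

tabulate-split : ∀ {n} (f : Fin (suc n) → A) (j : Fin n) →
  ∃₂ λ P Q → tabulate f ≡ P ++ f (inject₁ j) ∷ f (suc j) ∷ Q
tabulate-split f zero    = [] , _ , refl
tabulate-split f (suc j) with tabulate-split (f ∘ suc) j
... | P , Q , eq = f zero ∷ P , Q , cong (f zero ∷_) eq

Unique-++-∷-∷⁻ : ∀ P {Q} {x y : A} → Unique (P ++ x ∷ y ∷ Q) →
  All (λ z → x ≢ z × y ≢ z) P × All (λ z → x ≢ z × y ≢ z) Q
Unique-++-∷-∷⁻ [] ((_ ∷ x∉Q) ∷ y∉Q ∷ _) = [] , All.zip (x∉Q , y∉Q)
Unique-++-∷-∷⁻ (p ∷ P) (p∉ ∷ uniq) with ++⁻ P p∉ | Unique-++-∷-∷⁻ P uniq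
... | _ , p≢x ∷ p≢y ∷ _ | P-ok , Q-ok = (≢-sym p≢x , ≢-sym p≢y) ∷ P-ok , Q-ok

extend : ∀ {n} → A → (Fin n → A) → ℕ → A
extend {n = n} d b v with v <? n
... | yes v<n = b (fromℕ< v<n)
... | no  _   = d

module _ {n} (d : A) (b : Fin n → A) where

  extend-toℕ : ∀ i → b i ≡ extend d b (toℕ i)
  extend-toℕ i with toℕ i <? n
  ... | yes i<n = cong b (sym (fromℕ<-toℕ i i<n))
  ... | no  i≮n = contradiction (toℕ<n i) i≮n

module _ {n} (d : A) (b : Fin (suc n) → A) where

  extend-inject₁ : ∀ i → b (inject₁ i) ≡ extend d b (toℕ i)
  extend-inject₁ i = trans (extend-toℕ d b (inject₁ i)) (cong (extend d b) (toℕ-inject₁ i))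

  extend-fromℕ : b (fromℕ n) ≡ extend d b n
  extend-fromℕ = trans (extend-toℕ d b (fromℕ n)) (cong (extend d b) (toℕ-fromℕ n))

LeftToRightMax : ∀ {n} → (Fin n → ℕ) → Fin n → Set
LeftToRightMax w i = ∀ j → toℕ j < toℕ i → w j < w i

module _ {n} {w : Fin (suc n) → ℕ} {i : Fin n} where

  ltrMax-uncons : LeftToRightMax w (suc i) → w zero < w (suc i) × LeftToRightMax (w ∘ suc) i
  ltrMax-uncons max = max zero z<s , λ j j<i → max (suc j) (s<s j<i)

  ltrMax-cons : w zero < w (suc i) → LeftToRightMax (w ∘ suc) i → LeftToRightMax w (suc i)
  ltrMax-cons w₀<wᵢ max zero    _   = w₀<wᵢ
  ltrMax-cons w₀<wᵢ max (suc j) j<i = max j (s<s⁻¹ j<i)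

StrictlyMonotoneOn : (ℕ → Set) → (ℕ → ℕ) → Set
StrictlyMonotoneOn S f = ∀ {u v} → S u → S v → u < v → f u < f v

<ᵇ-strictlyMonotone : ∀ {S f} → StrictlyMonotoneOn S f → S u → S v → (f u <ᵇ f v) ≡ (u <ᵇ v)
<ᵇ-strictlyMonotone {u} {v} {f = f} mono Su Sv with <-cmp u v
... | tri< u<v _ _ = trans (<ᵇ-true (mono Su Sv u<v)) (sym (<ᵇ-true u<v))
... | tri≈ _ refl _ = trans (<ᵇ-false {f u} (<-irrefl refl)) (sym (<ᵇ-false {u} (<-irrefl refl)))
... | tri> _ _ v<u = trans (<ᵇ-false (<-asym (mono Sv Su v<u))) (sym (<ᵇ-false (<-asym v<u)))

squeeze : ℕ → ℕ → ℕ
squeeze k v = if k <ᵇ v then pred v else v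

module _ {k : ℕ} where

  squeeze-below : v < k → squeeze k v ≡ v
  squeeze-below v<k rewrite <ᵇ-false (<-asym v<k) = refl

  squeeze-above : k < v → squeeze k v ≡ pred v
  squeeze-above k<v rewrite <ᵇ-true k<v = refl

  squeeze-strictlyMonotone : StrictlyMonotoneOn (_≢ k) (squeeze k)
  squeeze-strictlyMonotone {u} {v} u≢k v≢k u<v with <-cmp u k | <-cmp v k
  ... | tri≈ _ u≡k _ | _            = contradiction u≡k u≢k
  ... | _            | tri≈ _ v≡k _ = contradiction v≡k v≢k
  ... | tri> _ _ k<u | tri< v<k _ _ = contradiction (<-trans k<u (<-trans u<v v<k)) (<-irrefl refl)
  ... | tri< u<k _ _ | tri< v<k _ _ rewrite squeeze-below u<k | squeeze-below v<k = u<v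
  ... | tri< u<k _ _ | tri> _ _ k<v rewrite squeeze-below u<k | squeeze-above k<v = <-≤-trans u<k (<⇒≤pred k<v)
  ... | tri> _ _ k<u | tri> _ _ k<v rewrite squeeze-above k<u | squeeze-above k<v =
    pred-mono-< {{>-nonZero (≤-<-trans z≤n k<u)}} u<v

module _ {top k : ℕ} where

  contractWord-∷ : ∀ v ws → v < top → contractWord top k (v ∷ ws) ≡ squeeze k v ∷ contractWord top k ws
  contractWord-∷ v []      v<top rewrite <ᵇ-true v<top | ∧-identityʳ (k <ᵇ v) = refl
  contractWord-∷ v (_ ∷ _) v<top
    rewrite ≡ᵇ-false (<⇒≢ v<top) | <ᵇ-true v<top | ∧-identityʳ (k <ᵇ v) = refl

  contractWord-++ : ∀ ws rest → All (_< top) ws →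
    contractWord top k (ws ++ rest) ≡ map (squeeze k) ws ++ contractWord top k rest
  contractWord-++ []       rest []              = refl
  contractWord-++ (v ∷ ws) rest (v<top ∷ ws<top) =
    trans (contractWord-∷ v (ws ++ rest) v<top) (cong (_ ∷_) (contractWord-++ ws rest ws<top))

  contractWord-squeeze : ∀ ws → All (_< top) ws → contractWord top k ws ≡ map (squeeze k) ws
  contractWord-squeeze []       []              = refl
  contractWord-squeeze (v ∷ ws) (v<top ∷ ws<top) =
    trans (contractWord-∷ v ws v<top) (cong (_ ∷_) (contractWord-squeeze ws ws<top))

contractWord-pair : ∀ m k ws → contractWord (suc m) k (suc m ∷ k ∷ ws) ≡ m ∷ contractWord (suc m) k ws
contractWord-pair m k ws rewrite ≡ᵇ-refl m | ≡ᵇ-refl k = refl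

word-tabulate : ∀ {n} (σ : Permutation′ n) → word σ ≡ tabulate (λ i → toℕ (σ ⟨$⟩ʳ i))
word-tabulate σ = map-tabulate (λ i → i) _

word-bounded : ∀ {n} (σ : Permutation′ n) → All (_< n) (word σ)
word-bounded {n} σ rewrite word-tabulate σ = tabulate⁺ (λ i → toℕ<n (σ ⟨$⟩ʳ i))

word-unique : ∀ {n} (σ : Permutation′ n) → Unique (word σ)
word-unique σ rewrite word-tabulate σ = Unique.tabulate⁺ (Injection.injective (↔⇒↣ σ) ∘ toℕ-injective)

module Dendriform {r ℓr c ℓ} {R : CommutativeRing r ℓr} (D : DendriformAlgebra R c ℓ) where

  open DendriformAlgebra D

  ✶-cong : ∀ {x x′ y y′} → x ≈ᴹ x′ → y ≈ᴹ y′ → x ✶ y ≈ᴹ x′ ✶ y′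
  ✶-cong x≈x′ y≈y′ = +ᴹ-cong (≺-cong x≈x′ y≈y′) (≻-cong x≈x′ y≈y′)

  ✶-assoc : ∀ x y z → (x ✶ y) ✶ z ≈ᴹ x ✶ (y ✶ z)
  ✶-assoc x y z = begin
    (x ✶ y) ✶ z                                   ≈⟨ +ᴹ-cong (≺-+ˡ (x ≺ y) (x ≻ y) z) ≈ᴹ-refl ⟩
    ((x ≺ y) ≺ z +ᴹ (x ≻ y) ≺ z) +ᴹ (x ✶ y) ≻ z   ≈⟨ +ᴹ-cong (+ᴹ-cong (dend₁ x y z) (dend₂ x y z))
                                                            (≈ᴹ-sym (dend₃ x y z)) ⟩
    (x ≺ (y ✶ z) +ᴹ x ≻ (y ≺ z)) +ᴹ x ≻ (y ≻ z)   ≈⟨ +ᴹ-assoc _ _ _ ⟩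
    x ≺ (y ✶ z) +ᴹ (x ≻ (y ≺ z) +ᴹ x ≻ (y ≻ z))   ≈⟨ +ᴹ-cong ≈ᴹ-refl (≻-+ʳ x (y ≺ z) (y ≻ z)) ⟨
    x ✶ (y ✶ z)                                   ∎
    where open SetoidReasoning ≈ᴹ-setoid

  Letter : Set c
  Letter = ℕ × Carrierᴹ

  -- top is the largest key read so far and cur the ℓ-value of the current block; a letter
  -- opens a new block (its position is in E_σ) exactly when its key exceeds top.
  run : ℕ → Carrierᴹ → List Letter → Carrierᴹ
  run top cur []             = cur
  run top cur ((v , x) ∷ ws) = if top <ᵇ v then cur ✶ run v x ws else run top (cur ▷ x) ws

  eval : List Letter → Carrierᴹ
  eval []             = 0ᴹ  -- junk: a permutation word is never empty
  eval ((v , x) ∷ ws) = run v x ws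

  spell : (ℕ → Carrierᴹ) → List ℕ → List Letter
  spell g = map (λ v → v , g v)

  assemble≡run : ∀ {k} (key : Fin k → ℕ) (val : Fin k → Carrierᴹ) (flag : Fin k → Bool) top cur →
    (∀ i → Reflects (top < key i × LeftToRightMax key i) (flag i)) →
    assemble cur (tabulate (λ i → flag i , val i)) ≡ run top cur (tabulate (λ i → key i , val i))
  assemble≡run {zero}  _   _   _    _   _   _ = refl
  assemble≡run {suc k} key val flag top cur r with flag zero | r zero
  ... | true  | ofʸ (top<key₀ , _) rewrite <ᵇ-true top<key₀ =
    cong (cur ✶_) (assemble≡run (key ∘ suc) (val ∘ suc) (flag ∘ suc) (key zero) (val zero) λ i →
      Reflects-map (ltrMax-uncons ∘ proj₂)
                   (λ (key₀< , max) → <-trans top<key₀ key₀< , ltrMax-cons key₀< max) (r (suc i)))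
  ... | false | ofⁿ ¬new rewrite <ᵇ-false (λ top<key₀ → ¬new (top<key₀ , λ _ ())) =
    assemble≡run (key ∘ suc) (val ∘ suc) (flag ∘ suc) top (cur ▷ val zero) λ i →
      Reflects-map (map₂ (proj₂ ∘ ltrMax-uncons))
                   (λ (top< , max) → top< , ltrMax-cons (≤-<-trans key₀≤top top<) max) (r (suc i))
    where
    key₀≤top : key zero ≤ top
    key₀≤top = ≮⇒≥ λ top<key₀ → ¬new (top<key₀ , λ _ ())

  inE-reflects : ∀ {n} (σ : Permutation′ n) i →
    Reflects (LeftToRightMax (λ j → toℕ (σ ⟨$⟩ʳ j)) i) (inE σ i)
  inE-reflects {n} σ i =
    Reflects-map (λ every j → All.lookup every (∈-allFin j)) (λ max → All.tabulate λ {j} _ → max j)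
      (all-reflects (λ j → <ᵇ-reflects-< _ _ →-reflects <ᵇ-reflects-< _ _) (allFin n))

  T≡eval-spell : ∀ {k} (σ : Permutation′ (suc k)) {b : Fin (suc k) → Carrierᴹ} {g : ℕ → Carrierᴹ} →
    (∀ i → b i ≡ g (toℕ i)) → T σ b ≡ eval (spell g (word σ))
  T≡eval-spell {k} σ {b} {g} b≡g = begin
    T σ b
      ≡⟨ cong (assemble (b (σ ⟨$⟩ʳ zero)))
              (map-tabulate (λ i → i) (λ i → inE σ (suc i) , b (σ ⟨$⟩ʳ suc i))) ⟩
    assemble (b (σ ⟨$⟩ʳ zero)) (tabulate λ i → inE σ (suc i) , b (σ ⟨$⟩ʳ suc i))
      ≡⟨ assemble≡run _ _ _ _ _ (λ i →
           Reflects-map ltrMax-uncons (uncurry ltrMax-cons) (inE-reflects σ (suc i))) ⟩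
    eval (tabulate λ i → toℕ (σ ⟨$⟩ʳ i) , b (σ ⟨$⟩ʳ i))
      ≡⟨ cong eval (tabulate-cong λ i → cong (toℕ (σ ⟨$⟩ʳ i) ,_) (b≡g (σ ⟨$⟩ʳ i))) ⟩
    eval (tabulate λ i → toℕ (σ ⟨$⟩ʳ i) , g (toℕ (σ ⟨$⟩ʳ i)))
      ≡⟨ cong eval (trans (cong (spell g) (word-tabulate σ))
                          (map-tabulate (λ i → toℕ (σ ⟨$⟩ʳ i)) (λ v → v , g v))) ⟨
    eval (spell g (word σ)) ∎
    where open ≡-Reasoning

  KeysBelow : ℕ → List Letter → Set c
  KeysBelow t = All (λ w → proj₁ w < t)

  run-split : ∀ {top t cur x rest} ws → top < t → KeysBelow t ws →
    run top cur (ws ++ (t , x) ∷ rest) ≈ᴹ run top cur ws ✶ run t x rest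
  run-split [] top<t [] rewrite <ᵇ-true top<t = ≈ᴹ-refl
  run-split {top} {cur = cur} ((v , y) ∷ ws) top<t (v<t ∷ ws<t) with top <ᵇ v
  ... | true  = ≈ᴹ-trans (✶-cong ≈ᴹ-refl (run-split ws v<t ws<t)) (≈ᴹ-sym (✶-assoc _ _ _))
  ... | false = run-split ws top<t ws<t

  eval-split : ∀ {t x rest} w ws → KeysBelow t (w ∷ ws) →
    eval ((w ∷ ws) ++ (t , x) ∷ rest) ≈ᴹ eval (w ∷ ws) ✶ run t x rest
  eval-split (v , y) ws (v<t ∷ ws<t) = run-split ws v<t ws<t

  run-absorb : ∀ {t k x y ws} → k < t → run t x ((k , y) ∷ ws) ≡ run t (x ▷ y) ws
  run-absorb k<t rewrite <ᵇ-false (<-asym k<t) = refl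

  eval-contract : ∀ {t k x y rest} ws → KeysBelow t ws → k < t →
    eval (ws ++ (t , x) ∷ (k , y) ∷ rest) ≈ᴹ eval (ws ++ (t , x ▷ y) ∷ rest)
  eval-contract {y = y} {rest} [] _ k<t = ≈ᴹ-reflexive (run-absorb {y = y} {rest} k<t)
  eval-contract {t} {k} {x} {y} {rest} (w ∷ ws) ws<t k<t = begin
    eval ((w ∷ ws) ++ (t , x) ∷ (k , y) ∷ rest) ≈⟨ eval-split w ws ws<t ⟩
    eval (w ∷ ws) ✶ run t x ((k , y) ∷ rest)    ≡⟨ cong (eval (w ∷ ws) ✶_) (run-absorb {y = y} {rest} k<t) ⟩
    eval (w ∷ ws) ✶ run t (x ▷ y) rest          ≈⟨ eval-split w ws ws<t ⟨
    eval ((w ∷ ws) ++ (t , x ▷ y) ∷ rest)       ∎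
    where open SetoidReasoning ≈ᴹ-setoid

  module _ {S : ℕ → Set} {f : ℕ → ℕ} (mono : StrictlyMonotoneOn S f) where

    run-relabel : ∀ {top cur ws} → S top → All (S ∘ proj₁) ws →
      run (f top) cur (map (map₁ f) ws) ≡ run top cur ws
    run-relabel Stop [] = refl
    run-relabel {top} {cur} {(v , x) ∷ ws} Stop (Sv ∷ Sws)
      rewrite <ᵇ-strictlyMonotone mono Stop Sv with top <ᵇ v
    ... | true  = cong (cur ✶_) (run-relabel Sv Sws)
    ... | false = run-relabel Stop Sws

    eval-relabel : ∀ {ws} → All (S ∘ proj₁) ws → eval (map (map₁ f) ws) ≡ eval ws
    eval-relabel []         = refl
    eval-relabel (Sv ∷ Sws) = run-relabel Sv Sws

  T-fixedLast : ∀ {m} (a : Fin (suc (suc m)) → Carrierᴹ)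
    (σ : Permutation′ (suc (suc m))) (σ̃ : Permutation′ (suc m)) →
    σ ⟨$⟩ʳ fromℕ (suc m) ≡ fromℕ (suc m) →
    (∀ i → toℕ (σ̃ ⟨$⟩ʳ i) ≡ toℕ (σ ⟨$⟩ʳ inject₁ i)) →
    T σ a ≈ᴹ T σ̃ (a ∘ inject₁) ✶ a (fromℕ (suc m))
  T-fixedLast {m} a σ σ̃ σ-fixes-last σ̃≗σ = begin
    T σ a                                               ≡⟨ T≡eval-spell σ (extend-toℕ 0ᴹ a) ⟩
    eval (spell â (word σ))                             ≡⟨ cong (eval ∘ spell â) word-σ ⟩
    eval (spell â (word σ̃ ++ suc m ∷ []))               ≡⟨ cong eval (map-++ _ (word σ̃) _) ⟩
    eval (spell â (word σ̃) ++ (suc m , â (suc m)) ∷ []) ≈⟨ eval-split _ _ (map⁺ (word-bounded σ̃)) ⟩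
    eval (spell â (word σ̃)) ✶ â (suc m)                 ≡⟨ cong₂ _✶_ (T≡eval-spell σ̃ (extend-inject₁ 0ᴹ a))
                                                                   (extend-fromℕ 0ᴹ a) ⟨
    T σ̃ (a ∘ inject₁) ✶ a (fromℕ (suc m))               ∎
    where
    open SetoidReasoning ≈ᴹ-setoid
    â : ℕ → Carrierᴹ
    â = extend 0ᴹ a
    word-σ : word σ ≡ word σ̃ ++ suc m ∷ []
    word-σ = trans (word-tabulate σ) (trans (tabulate-∷ʳ (λ i → toℕ (σ ⟨$⟩ʳ i)))
      (cong₂ (λ ws v → ws ++ v ∷ [])
        (trans (tabulate-cong (sym ∘ σ̃≗σ)) (sym (word-tabulate σ̃)))
        (trans (cong toℕ σ-fixes-last) (toℕ-fromℕ (suc m)))))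

  module _ {m} (k₀ : Fin (suc m)) (a : Fin (suc (suc m)) → Carrierᴹ) where

    private
      k : ℕ
      k = toℕ k₀

      â : ℕ → Carrierᴹ
      â = extend 0ᴹ a

      k<top : k < suc m
      k<top = toℕ<n k₀

      Good : ℕ → Set
      Good v = v < suc m × v ≢ k

    dropInsertℕ : ℕ → Carrierᴹ
    dropInsertℕ w = if w <ᵇ k then â w else if w ≡ᵇ m then â (suc m) ▷ â k else â (suc w)

    dropInsert-toℕ : ∀ i → dropInsert a k₀ i ≡ dropInsertℕ (toℕ i)
    dropInsert-toℕ i =
      cong₂ (λ x y → if toℕ i <ᵇ k then x else y) (extend-inject₁ 0ᴹ a i)
        (cong₂ (λ x y → if toℕ i ≡ᵇ m then x else y)
          (cong₂ _▷_ (extend-fromℕ 0ᴹ a) (extend-inject₁ 0ᴹ a k₀)) (extend-toℕ 0ᴹ a (suc i)))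

    dropInsertℕ-squeeze : ∀ {v} → Good v → dropInsertℕ (squeeze k v) ≡ â v
    dropInsertℕ-squeeze {v} (v<top , v≢k) with <-cmp v k
    ... | tri< v<k _ _ rewrite squeeze-below v<k | <ᵇ-true v<k = refl
    ... | tri≈ _ v≡k _ = contradiction v≡k v≢k
    dropInsertℕ-squeeze {suc w} (w<m , _) | tri> _ _ k<v
      rewrite squeeze-above k<v | <ᵇ-false (≤⇒≯ (<⇒≤pred k<v)) | ≡ᵇ-false (<⇒≢ (s<s⁻¹ w<m))
      = refl

    dropInsertℕ-top : dropInsertℕ m ≡ â (suc m) ▷ â k
    dropInsertℕ-top rewrite <ᵇ-false (≤⇒≯ (<⇒≤pred k<top)) | ≡ᵇ-refl m = refl

    word-split : (σ : Permutation′ (suc (suc m))) →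
      (∃[ j ] (σ ⟨$⟩ʳ inject₁ j ≡ fromℕ (suc m)) × (σ ⟨$⟩ʳ suc j ≡ inject₁ k₀)) →
      ∃₂ λ P Q → word σ ≡ P ++ suc m ∷ k ∷ Q × All Good P × All Good Q
    word-split σ (j , σj≡top , σj+1≡k) with tabulate-split (λ i → toℕ (σ ⟨$⟩ʳ i)) j
    ... | P , Q , split = P , Q , word-σ , All.zipWith good (proj₁ bounds , proj₁ distinct)
                              , All.zipWith good (All.tail (All.tail (proj₂ bounds)) , proj₂ distinct)
      where
      word-σ : word σ ≡ P ++ suc m ∷ k ∷ Q
      word-σ = trans (word-tabulate σ) (trans split (cong₂ (λ x y → P ++ x ∷ y ∷ Q)
        (trans (cong toℕ σj≡top) (toℕ-fromℕ (suc m))) (trans (cong toℕ σj+1≡k) (toℕ-inject₁ k₀))))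
      Fresh : ℕ → Set
      Fresh v = suc m ≢ v × k ≢ v
      bounds : All (_< suc (suc m)) P × All (_< suc (suc m)) (suc m ∷ k ∷ Q)
      bounds = ++⁻ P (subst (All (_< suc (suc m))) word-σ (word-bounded σ))
      distinct : All Fresh P × All Fresh Q
      distinct = Unique-++-∷-∷⁻ P (subst Unique word-σ (word-unique σ))
      good : ∀ {v} → v < suc (suc m) × Fresh v → Good v
      good (v<top+1 , top≢v , k≢v) = ≤∧≢⇒< (s≤s⁻¹ v<top+1) (≢-sym top≢v) , ≢-sym k≢v

    contractWord-split : ∀ {P Q} → All Good P → All Good Q →
      contractWord (suc m) k (P ++ suc m ∷ k ∷ Q) ≡ map (squeeze k) P ++ m ∷ map (squeeze k) Q
    contractWord-split {P} {Q} goodP goodQ = begin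
      contractWord (suc m) k (P ++ suc m ∷ k ∷ Q)
        ≡⟨ contractWord-++ P _ (All.map proj₁ goodP) ⟩
      map (squeeze k) P ++ contractWord (suc m) k (suc m ∷ k ∷ Q)
        ≡⟨ cong (map (squeeze k) P ++_) (contractWord-pair m k Q) ⟩
      map (squeeze k) P ++ m ∷ contractWord (suc m) k Q
        ≡⟨ cong (λ ws → map (squeeze k) P ++ m ∷ ws) (contractWord-squeeze Q (All.map proj₁ goodQ)) ⟩
      map (squeeze k) P ++ m ∷ map (squeeze k) Q
        ∎
      where open ≡-Reasoning

    spell-squeeze : ∀ {ws} → All Good ws →
      spell dropInsertℕ (map (squeeze k) ws) ≡ map (map₁ (squeeze k)) (spell â ws)
    spell-squeeze []             = refl
    spell-squeeze (good ∷ goods) = cong₂ _∷_ (cong (_ ,_) (dropInsertℕ-squeeze good)) (spell-squeeze goods)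

    spell-contract : ∀ {P Q} → All Good P → All Good Q →
      spell dropInsertℕ (map (squeeze k) P ++ m ∷ map (squeeze k) Q)
        ≡ map (map₁ (squeeze k)) (spell â P ++ (suc m , â (suc m) ▷ â k) ∷ spell â Q)
    spell-contract {P} {Q} goodP goodQ = begin
      spell dropInsertℕ (map (squeeze k) P ++ m ∷ map (squeeze k) Q)
        ≡⟨ map-++ _ (map (squeeze k) P) _ ⟩
      spell dropInsertℕ (map (squeeze k) P) ++ (m , dropInsertℕ m) ∷ spell dropInsertℕ (map (squeeze k) Q)
        ≡⟨ cong₂ _++_ (spell-squeeze goodP)
                      (cong₂ _∷_ (cong₂ _,_ (sym (squeeze-above k<top)) dropInsertℕ-top) (spell-squeeze goodQ)) ⟩
      map (map₁ (squeeze k)) (spell â P) ++ (squeeze k (suc m) , â (suc m) ▷ â k)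
                                         ∷ map (map₁ (squeeze k)) (spell â Q)
        ≡⟨ map-++ _ (spell â P) _ ⟨
      map (map₁ (squeeze k)) (spell â P ++ (suc m , â (suc m) ▷ â k) ∷ spell â Q) ∎
      where open ≡-Reasoning

    T-contract : (σ : Permutation′ (suc (suc m))) (σ̃ : Permutation′ (suc m)) →
      (∃[ j ] (σ ⟨$⟩ʳ inject₁ j ≡ fromℕ (suc m)) × (σ ⟨$⟩ʳ suc j ≡ inject₁ k₀)) →
      word σ̃ ≡ contractWord (suc m) k (word σ) →
      T σ a ≈ᴹ T σ̃ (dropInsert a k₀)
    T-contract σ σ̃ pair word-σ̃ with word-split σ pair
    ... | P , Q , word-σ , goodP , goodQ = begin
      T σ a
        ≡⟨ T≡eval-spell σ (extend-toℕ 0ᴹ a) ⟩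
      eval (spell â (word σ))
        ≡⟨ cong (eval ∘ spell â) word-σ ⟩
      eval (spell â (P ++ suc m ∷ k ∷ Q))
        ≡⟨ cong eval (map-++ _ P _) ⟩
      eval (spell â P ++ (suc m , â (suc m)) ∷ (k , â k) ∷ spell â Q)
        ≈⟨ eval-contract (spell â P) P<top k<top ⟩
      eval merged
        ≡⟨ eval-relabel squeeze-strictlyMonotone keys≢k ⟨
      eval (map (map₁ (squeeze k)) merged)
        ≡⟨ cong eval (spell-contract goodP goodQ) ⟨
      eval (spell dropInsertℕ (map (squeeze k) P ++ m ∷ map (squeeze k) Q))
        ≡⟨ cong (eval ∘ spell dropInsertℕ) word-σ̃-split ⟨
      eval (spell dropInsertℕ (word σ̃))
        ≡⟨ T≡eval-spell σ̃ dropInsert-toℕ ⟨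
      T σ̃ (dropInsert a k₀)
        ∎
      where
      open SetoidReasoning ≈ᴹ-setoid
      merged : List Letter
      merged = spell â P ++ (suc m , â (suc m) ▷ â k) ∷ spell â Q
      P<top : KeysBelow (suc m) (spell â P)
      P<top = map⁺ (All.map proj₁ goodP)
      keys≢k : All ((_≢ k) ∘ proj₁) merged
      keys≢k = ++⁺ (map⁺ (All.map proj₂ goodP)) (≢-sym (<⇒≢ k<top) ∷ map⁺ (All.map proj₂ goodQ))
      word-σ̃-split : word σ̃ ≡ map (squeeze k) P ++ m ∷ map (squeeze k) Q
      word-σ̃-split =
        trans word-σ̃ (trans (cong (contractWord (suc m) k) word-σ) (contractWord-split goodP goodQ))

lemma6p1 : ∀ {r ℓr c ℓ} (R : CommutativeRing r ℓr) (D : DendriformAlgebra R c ℓ)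
    (m : ℕ) (a : Fin (suc (suc m)) → DendriformAlgebra.Carrierᴹ D) →
    let open DendriformAlgebra D in
    ((σ : Permutation′ (suc (suc m))) (σ̃ : Permutation′ (suc m)) →
      σ ⟨$⟩ʳ fromℕ (suc m) ≡ fromℕ (suc m) →
      (∀ i → toℕ (σ̃ ⟨$⟩ʳ i) ≡ toℕ (σ ⟨$⟩ʳ inject₁ i)) →
      T σ a ≈ᴹ (T σ̃ (λ i → a (inject₁ i)) ✶ a (fromℕ (suc m))))
    ×
    ((k₀ : Fin (suc m)) (σ : Permutation′ (suc (suc m))) (σ̃ : Permutation′ (suc m)) →
      (∃[ j ] ((σ ⟨$⟩ʳ inject₁ j ≡ fromℕ (suc m)) × (σ ⟨$⟩ʳ Fin.suc j ≡ inject₁ k₀))) →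
      word σ̃ ≡ contractWord (suc m) (toℕ k₀) (word σ) →
      T σ a ≈ᴹ T σ̃ (dropInsert a k₀))
lemma6p1 R D m a = T-fixedLast a , λ k₀ → T-contract k₀ a
  where open Dendriform D
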